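{- Let $\mathbf{Q}=(L,Q_1,\ldots,Q_n,R)$ be a $(4,2)$-flexipath in a matroid $M$ with $\sqcap(L,R)=1=\sqcap^*(L,R)$ and $\sqcap(L,Q_i)=1$ for all $i\in[n]$. Then $n\le 3$.
   Context: Let $M$ be a matroid on ground set $E$ with rank function $r$. $\lambda(A)=r(A)+r(E-A)-r(M)$; for disjoint $X,Y$, $\sqcap(X,Y)=r(X)+r(Y)-r(X\cup Y)$ and $\sqcap^*(X,Y)$ is the same quantity in $M^*$; $\kappa(X,Y)=\min\{\lambda(Z):X\subseteq Z\subseteq E-Y\}$. A path of $4$-separations is an ordered partition $(L,P_1,\ldots,P_n,R)$ of $E$ with $\kappa(L,R)=3$ and $\lambda(L\cup P_1\cup\cdots\cup P_i)=3$ for all $i\in\{0,\ldots,n\}$; a $4$-flexipath if this holds for every reordering of $P_1,\ldots,P_n$ (with $L,R$ fixed); a $(4,2)$-flexipath if moreover $\lambda(P_i)=2$ for all $i$ and $\lambda(P_i\cup P_j)>2$ for all distinct $i,j$. -}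

module Defs where

open import Data.Nat using (ℕ; _+_; _∸_; _≤_; _>_)
open import Data.Fin using (Fin)
open import Data.Fin.Subset using (Subset; _∪_; _∩_; ∁; ⊤; ⊥; ∣_∣; _⊆_; ⋃)
open import Data.Fin.Permutation using (Permutation′; _⟨$⟩ʳ_)
open import Data.List using (List; map; take; allFin)
open import Data.Product using (Σ; _×_)
open import Relation.Binary.PropositionalEquality using (_≡_; _≢_)

record Matroid (m : ℕ) : Set where
  field
    r          : Subset m → ℕ
    r-bounded  : ∀ X → r X ≤ ∣ X ∣
    r-mono     : ∀ {X Y} → X ⊆ Y → r X ≤ r Y
    r-submod   : ∀ X Y → r (X ∪ Y) + r (X ∩ Y) ≤ r X + r Y

module _ {m : ℕ} (M : Matroid m) where
  open Matroid M

  rM : ℕ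
  rM = r ⊤

  r* : Subset m → ℕ
  r* X = ∣ X ∣ + r (∁ X) ∸ rM

  λM : Subset m → ℕ
  λM A = r A + r (∁ A) ∸ rM

  ⊓ : Subset m → Subset m → ℕ
  ⊓ X Y = r X + r Y ∸ r (X ∪ Y)

  ⊓* : Subset m → Subset m → ℕ
  ⊓* X Y = r* X + r* Y ∸ r* (X ∪ Y)

  κ≡ : Subset m → Subset m → ℕ → Set
  κ≡ X Y k =
    Σ (Subset m) (λ Z → X ⊆ Z × Z ⊆ ∁ Y × λM Z ≡ k)
    × (∀ Z → X ⊆ Z → Z ⊆ ∁ Y → k ≤ λM Z)

Disjoint : ∀ {m} → Subset m → Subset m → Set
Disjoint X Y = X ∩ Y ≡ ⊥

-- (L, Q_1, ..., Q_n, R) is an ordered partition of E = Fin m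
-- (Q i is the part Q_{i+1}).
IsOrderedPartition : ∀ {m n} → Subset m → (Fin n → Subset m) → Subset m → Set
IsOrderedPartition {m} {n} L Q R =
  Disjoint L R
  × (∀ i → Disjoint L (Q i))
  × (∀ i → Disjoint (Q i) R)
  × (∀ i j → i ≢ j → Disjoint (Q i) (Q j))
  × (L ∪ (⋃ (map Q (allFin n)) ∪ R) ≡ ⊤)

prefixUnion : ∀ {m n} → Subset m → (Fin n → Subset m) → Permutation′ n → ℕ → Subset m
prefixUnion {n = n} L Q σ k = L ∪ ⋃ (take k (map (λ j → Q (σ ⟨$⟩ʳ j)) (allFin n)))

-- (L, Q_1, ..., Q_n, R) is a 4-flexipath: a path of 4-separations for every
-- reordering of Q_1, ..., Q_n (L and R fixed).
Is4Flexipath : ∀ {m n} → Matroid m → Subset m → (Fin n → Subset m) → Subset m → Set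
Is4Flexipath {m} {n} M L Q R =
  IsOrderedPartition L Q R
  × κ≡ M L R 3
  × (∀ (σ : Permutation′ n) (k : ℕ) → k ≤ n → λM M (prefixUnion L Q σ k) ≡ 3)

Is42Flexipath : ∀ {m n} → Matroid m → Subset m → (Fin n → Subset m) → Subset m → Set
Is42Flexipath M L Q R =
  Is4Flexipath M L Q R
  × (∀ i → λM M (Q i) ≡ 2)
  × (∀ i j → i ≢ j → λM M (Q i ∪ Q j) > 2)

{-# OPTIONS --safe #-}
module Submission where

-- Write ℓ(X) = ⊓(L, X) and μ(X) = ⊓(L, R ∪ X) for unions X of middle parts, and P for the
-- union of all of them.  Every L ∪ Qᵢ and E − (R ∪ Qᵢ) is a 4-separation and κ(L, R) = 3, so
-- uncrossing keeps λ = 3 on the lattice these sets generate; on such pairs the rank function is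
-- modular, which makes ℓ submodular and μ supermodular there.  The identity
-- ⊓(L, Z) + λ(L ∪ Z) = ⊓(L, E − L − Z) + λ(Z) turns λ(Qᵢ) = 2 into μ(P − Qᵢ) = 2 and
-- λ(Qᵢ ∪ Qⱼ) ≥ 3 into μ(P − Qᵢ − Qⱼ) ≤ ℓ(Qᵢ ∪ Qⱼ), and ⊓*(L, R) = 1 gives ℓ(P) = 2.
--
-- If n ≥ 4, two of ℓ(Q₀ ∪ Q₁), ℓ(Q₀ ∪ Q₂), ℓ(Q₀ ∪ Q₃) lie on the same side of 3/2.  If two are
-- at most 1, submodularity of ℓ gives ℓ(P − Q₀) ≤ 1 and then ℓ(P) + ℓ(Q₁) ≤ 2, contradicting
-- ℓ(P) = 2.  If two are at least 2, supermodularity of μ gives μ(Q₀) ≥ 2, hence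
-- ℓ(Q₁ ∪ Q₂) ≥ 2 and μ(Q₁) ≥ 2, and finally 4 ≤ μ(Q₀) + μ(Q₁) ≤ μ(Q₀ ∪ Q₁) + ⊓(L, R) ≤ 3.

open import Defs
open import Data.Bool using (true; false)
open import Data.Empty using (⊥-elim)
import Data.Empty as Empty
open import Data.Fin using (Fin; zero; suc; #_; toℕ; fromℕ; _↑ˡ_; splitAt; join)
open import Data.Fin.Properties
  using (_≟_; toℕ<n; toℕ-fromℕ; toℕ-injective; splitAt-↑ˡ; splitAt⁻¹-↑ˡ; splitAt-join; ↑ˡ-injective)
open import Data.Fin.Permutation
  using (Permutation′; _⟨$⟩ʳ_; _⟨$⟩ˡ_; inverseˡ; inverseʳ; transpose; _∘ₚ_)
import Data.Fin.Permutation as Perm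
import Data.Fin.Permutation.Components as PC
open import Data.Fin.Subset
open import Data.Fin.Subset.Properties
open import Data.List using (List; []; _∷_; take; map; allFin)
import Data.List as List
open import Data.List.Properties using (map-tabulate)
open import Data.List.Relation.Unary.Any using (Any; here; there)
import Data.List.Relation.Unary.Any.Properties as Any
open import Data.Nat using (ℕ; zero; suc; _+_; _∸_; _≤_; _<_; z≤n; s≤s; s≤s⁻¹)
open import Data.Nat.Properties hiding (_≟_)
open import Data.Nat.Solver using (module +-*-Solver)
open import Data.Product using (_×_; _,_; proj₁; proj₂; ∃-syntax)
import Data.Product as Product
open import Data.Sum using (_⊎_; inj₁; inj₂; [_,_]′; map₂)
import Data.Sum as Sum
open import Data.Sum.Properties using (inj₂-injective)
open import Data.Vec using ([]; _∷_; tail; tabulate; lookup)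
open import Data.Vec.Properties using (lookup∘tabulate; []=⇒lookup; lookup⇒[]=)
open import Function using (_∘_; _⇔_; mk⇔; Equivalence; case_of_)
open import Relation.Nullary using (¬_; yes; no)
open import Relation.Nullary.Decidable using (True; toWitness; dec-true)
open import Relation.Binary.PropositionalEquality
  using (_≡_; _≢_; refl; sym; trans; cong; cong₂; subst; subst₂; module ≡-Reasoning)

open +-*-Solver using (solve; _:+_; _:=_)
open import Algebra.Properties.CommutativeSemigroup +-commutativeSemigroup using (interchange)

tight-sum : ∀ {a b c d} → a ≤ b → c ≤ d → b + d ≤ a + c → a ≡ b × c ≡ d
tight-sum {a} {b} {c} {d} a≤b c≤d bd≤ac =
  ≤-antisym a≤b (+-cancelʳ-≤ d b a (≤-trans bd≤ac (+-monoʳ-≤ a c≤d))) ,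
  ≤-antisym c≤d (+-cancelˡ-≤ b d c (≤-trans bd≤ac (+-monoˡ-≤ c a≤b)))

balance-≥ : ∀ {k x y z w} → k ≤ x → k ≤ y → x + y ≤ z + w → z ≤ k → k ≤ w
balance-≥ {k} {x} {y} {z} {w} k≤x k≤y le z≤k =
  +-cancelˡ-≤ k k w (≤-trans (+-mono-≤ k≤x k≤y) (≤-trans le (+-monoˡ-≤ w z≤k)))

balance-≤ : ∀ {k x y z w} → x ≤ k → y ≤ k → z + w ≤ x + y → k ≤ w → z ≤ k
balance-≤ {k} {x} {y} {z} {w} x≤k y≤k le k≤w =
  +-cancelʳ-≤ k z k (≤-trans (+-monoʳ-≤ z k≤w) (≤-trans le (+-mono-≤ x≤k y≤k)))

∪-distribˡ-∪ : ∀ {n} (A X Y : Subset n) → A ∪ (X ∪ Y) ≡ (A ∪ X) ∪ (A ∪ Y)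
∪-distribˡ-∪ []          []      []      = refl
∪-distribˡ-∪ (true ∷ A)  (_ ∷ X) (_ ∷ Y) = cong (true ∷_) (∪-distribˡ-∪ A X Y)
∪-distribˡ-∪ (false ∷ A) (_ ∷ X) (_ ∷ Y) = cong (_ ∷_) (∪-distribˡ-∪ A X Y)

∣∪∣-disjoint : ∀ {n} (X Y : Subset n) → Disjoint X Y → ∣ X ∪ Y ∣ ≡ ∣ X ∣ + ∣ Y ∣
∣∪∣-disjoint []          []          _ = refl
∣∪∣-disjoint (true ∷ X)  (false ∷ Y) d = cong suc (∣∪∣-disjoint X Y (cong tail d))
∣∪∣-disjoint (false ∷ X) (true ∷ Y)  d =
  trans (cong suc (∣∪∣-disjoint X Y (cong tail d))) (sym (+-suc ∣ X ∣ ∣ Y ∣))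
∣∪∣-disjoint (false ∷ X) (false ∷ Y) d = ∣∪∣-disjoint X Y (cong tail d)

module _ {m : ℕ} where

  disjoint⇒∉ : ∀ {X Y : Subset m} {x} → Disjoint X Y → x ∈ X → x ∉ Y
  disjoint⇒∉ X∩Y≡⊥ x∈X x∈Y = ∉⊥ (subst (_ ∈_) X∩Y≡⊥ (x∈p∩q⁺ (x∈X , x∈Y)))

  ∪-∁∪-disjoint : ∀ {X Y : Subset m} → Disjoint X Y → X ∪ ∁ (X ∪ Y) ≡ ∁ Y
  ∪-∁∪-disjoint {X} {Y} X∩Y≡⊥ = ⊆-antisym ⊆∁Y ∁Y⊆
    where
    ⊆∁Y : X ∪ ∁ (X ∪ Y) ⊆ ∁ Y
    ⊆∁Y x∈ = x∉p⇒x∈∁p ([ disjoint⇒∉ X∩Y≡⊥ , (λ x∈∁ x∈Y → x∈∁p⇒x∉p x∈∁ (x∈p∪q⁺ (inj₂ x∈Y))) ]′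
                         (x∈p∪q⁻ X _ x∈))
    ∁Y⊆ : ∁ Y ⊆ X ∪ ∁ (X ∪ Y)
    ∁Y⊆ {x} x∈∁Y with x ∈? X
    ... | yes x∈X = x∈p∪q⁺ (inj₁ x∈X)
    ... | no  x∉X = x∈p∪q⁺ (inj₂ (x∉p⇒x∈∁p (λ x∈X∪Y → [ x∉X , x∈∁p⇒x∉p x∈∁Y ]′ (x∈p∪q⁻ X Y x∈X∪Y))))

  ∈-⋃⁻ : ∀ {x} (ps : List (Subset m)) → x ∈ ⋃ ps → Any (x ∈_) ps
  ∈-⋃⁻ []       x∈ = ⊥-elim (∉⊥ x∈)
  ∈-⋃⁻ (p ∷ ps) x∈ = [ here , there ∘ ∈-⋃⁻ ps ]′ (x∈p∪q⁻ p (⋃ ps) x∈)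

  ∈-⋃⁺ : ∀ {x} {ps : List (Subset m)} → Any (x ∈_) ps → x ∈ ⋃ ps
  ∈-⋃⁺ (here x∈p)   = x∈p∪q⁺ (inj₁ x∈p)
  ∈-⋃⁺ (there x∈ps) = x∈p∪q⁺ (inj₂ (∈-⋃⁺ x∈ps))

  ∈-⋃-take⁻ : ∀ {N x} (g : Fin N → Subset m) k →
              x ∈ ⋃ (take k (List.tabulate g)) → ∃[ j ] toℕ j < k × x ∈ g j
  ∈-⋃-take⁻ {zero}  g zero    x∈ = ⊥-elim (∉⊥ x∈)
  ∈-⋃-take⁻ {zero}  g (suc k) x∈ = ⊥-elim (∉⊥ x∈)
  ∈-⋃-take⁻ {suc N} g zero    x∈ = ⊥-elim (∉⊥ x∈)
  ∈-⋃-take⁻ {suc N} g (suc k) x∈ with x∈p∪q⁻ (g zero) _ x∈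
  ... | inj₁ x∈g₀ = zero , s≤s z≤n , x∈g₀
  ... | inj₂ x∈gs with ∈-⋃-take⁻ (g ∘ suc) k x∈gs
  ...   | j , j<k , x∈gj = suc j , s≤s j<k , x∈gj

  ∈-⋃-take⁺ : ∀ {N x} (g : Fin N → Subset m) k j →
              toℕ j < k → x ∈ g j → x ∈ ⋃ (take k (List.tabulate g))
  ∈-⋃-take⁺ g (suc k) zero    _         x∈ = x∈p∪q⁺ (inj₁ x∈)
  ∈-⋃-take⁺ g (suc k) (suc j) (s≤s j<k) x∈ = x∈p∪q⁺ (inj₂ (∈-⋃-take⁺ (g ∘ suc) k j j<k x∈))

module _ {m k : ℕ} (g : Fin m → Fin k) where

  preimage : Subset k → Subset m
  preimage c = tabulate (λ x → lookup c (g x))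

  ∈-preimage⁻ : ∀ c {x} → x ∈ preimage c → g x ∈ c
  ∈-preimage⁻ c {x} x∈ = lookup⇒[]= (g x) c (trans (sym (lookup∘tabulate _ x)) ([]=⇒lookup x∈))

  ∈-preimage⁺ : ∀ c {x} → g x ∈ c → x ∈ preimage c
  ∈-preimage⁺ c {x} gx∈ = lookup⇒[]= x (preimage c) (trans (lookup∘tabulate _ x) ([]=⇒lookup gx∈))

  preimage-mono : ∀ {c d} → c ⊆ d → preimage c ⊆ preimage d
  preimage-mono {c} {d} c⊆d = ∈-preimage⁺ d ∘ c⊆d ∘ ∈-preimage⁻ c

  preimage-∪ : ∀ c d → preimage (c ∪ d) ≡ preimage c ∪ preimage d
  preimage-∪ c d = ⊆-antisym
    (λ x∈ → x∈p∪q⁺ (Sum.map (∈-preimage⁺ c) (∈-preimage⁺ d) (x∈p∪q⁻ c d (∈-preimage⁻ (c ∪ d) x∈))))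
    (λ x∈ → ∈-preimage⁺ (c ∪ d) (x∈p∪q⁺ (Sum.map (∈-preimage⁻ c) (∈-preimage⁻ d) (x∈p∪q⁻ _ _ x∈))))

  preimage-∩ : ∀ c d → preimage (c ∩ d) ≡ preimage c ∩ preimage d
  preimage-∩ c d = ⊆-antisym
    (λ x∈ → x∈p∩q⁺ (Product.map (∈-preimage⁺ c) (∈-preimage⁺ d) (x∈p∩q⁻ c d (∈-preimage⁻ (c ∩ d) x∈))))
    (λ x∈ → ∈-preimage⁺ (c ∩ d) (x∈p∩q⁺ (Product.map (∈-preimage⁻ c) (∈-preimage⁻ d) (x∈p∩q⁻ _ _ x∈))))

  preimage-∁ : ∀ c → preimage (∁ c) ≡ ∁ (preimage c)
  preimage-∁ c = ⊆-antisym
    (λ x∈ → x∉p⇒x∈∁p (x∈∁p⇒x∉p (∈-preimage⁻ (∁ c) x∈) ∘ ∈-preimage⁻ c))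
    (λ x∈ → ∈-preimage⁺ (∁ c) (x∉p⇒x∈∁p (x∈∁p⇒x∉p x∈ ∘ ∈-preimage⁺ c)))

  preimage-⊤ : preimage ⊤ ≡ ⊤
  preimage-⊤ = ⊆-antisym ⊆⊤ (λ _ → ∈-preimage⁺ ⊤ ∈⊤)

-- Connectivity of a monotone submodular set function

module Connectivity {k : ℕ} (f : Subset k → ℕ)
  (f-mono : ∀ {X Y} → X ⊆ Y → f X ≤ f Y)
  (f-submod : ∀ X Y → f (X ∪ Y) + f (X ∩ Y) ≤ f X + f Y) where

  open import Algebra.Lattice.Properties.BooleanAlgebra (∪-∩-booleanAlgebra k) using (deMorgan₁; deMorgan₂)

  λᶠ : Subset k → ℕ
  λᶠ A = f A + f (∁ A) ∸ f ⊤

  ⊓ᶠ : Subset k → Subset k → ℕ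
  ⊓ᶠ X Y = f X + f Y ∸ f (X ∪ Y)

  Modular : Subset k → Subset k → Set
  Modular X Y = f X + f Y ≡ f (X ∪ Y) + f (X ∩ Y)

  f-subadditive : ∀ X Y → f (X ∪ Y) ≤ f X + f Y
  f-subadditive X Y = ≤-trans (m≤m+n _ _) (f-submod X Y)

  ⊓ᶠ-exact : ∀ X Y → ⊓ᶠ X Y + f (X ∪ Y) ≡ f X + f Y
  ⊓ᶠ-exact X Y = m∸n+n≡m (f-subadditive X Y)

  λᶠ-exact : ∀ A → λᶠ A + f ⊤ ≡ f A + f (∁ A)
  λᶠ-exact A = m∸n+n≡m (subst (λ Z → f Z ≤ f A + f (∁ A)) (p∪∁p≡⊤ A) (f-subadditive A (∁ A)))

  ⊓ᶠ-monoʳ : ∀ A X Y → X ⊆ Y → ⊓ᶠ A X ≤ ⊓ᶠ A Y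
  ⊓ᶠ-monoʳ A X Y X⊆Y = +-cancelʳ-≤ (a + b) (⊓ᶠ A X) (⊓ᶠ A Y) (begin
    ⊓ᶠ A X + (a + b)    ≡⟨ sym (+-assoc (⊓ᶠ A X) a b) ⟩
    ⊓ᶠ A X + a + b      ≡⟨ cong (_+ b) (⊓ᶠ-exact A X) ⟩
    f A + f X + b       ≡⟨ +-assoc (f A) (f X) b ⟩
    f A + (f X + b)     ≡⟨ cong (f A +_) (+-comm (f X) b) ⟩
    f A + (b + f X)     ≤⟨ +-monoʳ-≤ (f A) submod ⟩
    f A + (a + f Y)     ≡⟨ cong (f A +_) (+-comm a (f Y)) ⟩
    f A + (f Y + a)     ≡⟨ sym (+-assoc (f A) (f Y) a) ⟩
    f A + f Y + a       ≡⟨ cong (_+ a) (⊓ᶠ-exact A Y) ⟨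
    ⊓ᶠ A Y + b + a      ≡⟨ +-assoc (⊓ᶠ A Y) b a ⟩
    ⊓ᶠ A Y + (b + a)    ≡⟨ cong (⊓ᶠ A Y +_) (+-comm b a) ⟩
    ⊓ᶠ A Y + (a + b)    ∎)
    where
    open ≤-Reasoning
    a = f (A ∪ X)
    b = f (A ∪ Y)
    A∪Y⊆ : A ∪ Y ⊆ (A ∪ X) ∪ Y
    A∪Y⊆ x∈ = [ (λ x∈A → x∈p∪q⁺ (inj₁ (x∈p∪q⁺ (inj₁ x∈A)))) , (λ x∈Y → x∈p∪q⁺ (inj₂ x∈Y)) ]′
                (x∈p∪q⁻ A Y x∈)
    X⊆ : X ⊆ (A ∪ X) ∩ Y
    X⊆ x∈X = x∈p∩q⁺ (x∈p∪q⁺ (inj₂ x∈X) , X⊆Y x∈X)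
    submod : b + f X ≤ a + f Y
    submod = ≤-trans (+-mono-≤ (f-mono A∪Y⊆) (f-mono X⊆)) (f-submod (A ∪ X) Y)

  ⊓ᶠ-submodular : ∀ A X Y → Modular (A ∪ X) (A ∪ Y) →
                  ⊓ᶠ A (X ∪ Y) + ⊓ᶠ A (X ∩ Y) ≤ ⊓ᶠ A X + ⊓ᶠ A Y
  ⊓ᶠ-submodular A X Y mod = +-cancelʳ-≤ (u + v) _ _ (begin
    ⊓ᶠ A (X ∪ Y) + ⊓ᶠ A (X ∩ Y) + (u + v)   ≡⟨ interchange (⊓ᶠ A (X ∪ Y)) _ u v ⟩
    ⊓ᶠ A (X ∪ Y) + u + (⊓ᶠ A (X ∩ Y) + v)   ≡⟨ cong₂ _+_ (⊓ᶠ-exact A (X ∪ Y)) (⊓ᶠ-exact A (X ∩ Y)) ⟩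
    f A + f (X ∪ Y) + (f A + f (X ∩ Y))     ≡⟨ interchange (f A) (f (X ∪ Y)) (f A) (f (X ∩ Y)) ⟩
    f A + f A + (f (X ∪ Y) + f (X ∩ Y))     ≤⟨ +-monoʳ-≤ (f A + f A) (f-submod X Y) ⟩
    f A + f A + (f X + f Y)                 ≡⟨ interchange (f A) (f A) (f X) (f Y) ⟩
    f A + f X + (f A + f Y)                 ≡⟨ cong₂ _+_ (⊓ᶠ-exact A X) (⊓ᶠ-exact A Y) ⟨
    ⊓ᶠ A X + a + (⊓ᶠ A Y + b)               ≡⟨ interchange (⊓ᶠ A X) a (⊓ᶠ A Y) b ⟩
    ⊓ᶠ A X + ⊓ᶠ A Y + (a + b)               ≡⟨ cong (⊓ᶠ A X + ⊓ᶠ A Y +_) A-mod ⟩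
    ⊓ᶠ A X + ⊓ᶠ A Y + (u + v)               ∎)
    where
    open ≤-Reasoning
    a = f (A ∪ X)
    b = f (A ∪ Y)
    u = f (A ∪ (X ∪ Y))
    v = f (A ∪ (X ∩ Y))
    A-mod : a + b ≡ u + v
    A-mod = trans mod (cong₂ (λ U V → f U + f V) (sym (∪-distribˡ-∪ A X Y)) (sym (∪-distribˡ-∩ A X Y)))

  ⊓ᶠ-supermodular : ∀ A X Y → Modular X Y →
                    ⊓ᶠ A X + ⊓ᶠ A Y ≤ ⊓ᶠ A (X ∪ Y) + ⊓ᶠ A (X ∩ Y)
  ⊓ᶠ-supermodular A X Y mod = +-cancelʳ-≤ (u + v) _ _ (begin
    ⊓ᶠ A X + ⊓ᶠ A Y + (u + v)               ≤⟨ +-monoʳ-≤ (⊓ᶠ A X + ⊓ᶠ A Y) A-submod ⟩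
    ⊓ᶠ A X + ⊓ᶠ A Y + (a + b)               ≡⟨ interchange (⊓ᶠ A X) (⊓ᶠ A Y) a b ⟩
    ⊓ᶠ A X + a + (⊓ᶠ A Y + b)               ≡⟨ cong₂ _+_ (⊓ᶠ-exact A X) (⊓ᶠ-exact A Y) ⟩
    f A + f X + (f A + f Y)                 ≡⟨ interchange (f A) (f X) (f A) (f Y) ⟩
    f A + f A + (f X + f Y)                 ≡⟨ cong (f A + f A +_) mod ⟩
    f A + f A + (f (X ∪ Y) + f (X ∩ Y))     ≡⟨ interchange (f A) (f A) (f (X ∪ Y)) (f (X ∩ Y)) ⟩
    f A + f (X ∪ Y) + (f A + f (X ∩ Y))     ≡⟨ cong₂ _+_ (⊓ᶠ-exact A (X ∪ Y)) (⊓ᶠ-exact A (X ∩ Y)) ⟨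
    ⊓ᶠ A (X ∪ Y) + u + (⊓ᶠ A (X ∩ Y) + v)   ≡⟨ interchange (⊓ᶠ A (X ∪ Y)) u (⊓ᶠ A (X ∩ Y)) v ⟩
    ⊓ᶠ A (X ∪ Y) + ⊓ᶠ A (X ∩ Y) + (u + v)   ∎)
    where
    open ≤-Reasoning
    a = f (A ∪ X)
    b = f (A ∪ Y)
    u = f (A ∪ (X ∪ Y))
    v = f (A ∪ (X ∩ Y))
    A-submod : u + v ≤ a + b
    A-submod = subst₂ (λ U V → f U + f V ≤ a + b) (sym (∪-distribˡ-∪ A X Y)) (sym (∪-distribˡ-∩ A X Y))
                      (f-submod (A ∪ X) (A ∪ Y))

  λᶠ-exact₂ : ∀ Z₁ Z₂ → λᶠ Z₁ + λᶠ Z₂ + (f ⊤ + f ⊤) ≡ f Z₁ + f Z₂ + (f (∁ Z₁) + f (∁ Z₂))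
  λᶠ-exact₂ Z₁ Z₂ = begin
    λᶠ Z₁ + λᶠ Z₂ + (f ⊤ + f ⊤)           ≡⟨ interchange (λᶠ Z₁) (λᶠ Z₂) (f ⊤) (f ⊤) ⟩
    λᶠ Z₁ + f ⊤ + (λᶠ Z₂ + f ⊤)           ≡⟨ cong₂ _+_ (λᶠ-exact Z₁) (λᶠ-exact Z₂) ⟩
    f Z₁ + f (∁ Z₁) + (f Z₂ + f (∁ Z₂))   ≡⟨ interchange (f Z₁) (f (∁ Z₁)) (f Z₂) (f (∁ Z₂)) ⟩
    f Z₁ + f Z₂ + (f (∁ Z₁) + f (∁ Z₂))   ∎
    where open ≡-Reasoning

  λᶠ-exact-∪∩ : ∀ Z₁ Z₂ → λᶠ (Z₁ ∪ Z₂) + λᶠ (Z₁ ∩ Z₂) + (f ⊤ + f ⊤) ≡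
                f (Z₁ ∪ Z₂) + f (Z₁ ∩ Z₂) + (f (∁ Z₁ ∪ ∁ Z₂) + f (∁ Z₁ ∩ ∁ Z₂))
  λᶠ-exact-∪∩ Z₁ Z₂ = begin
    λᶠ (Z₁ ∪ Z₂) + λᶠ (Z₁ ∩ Z₂) + (f ⊤ + f ⊤)
      ≡⟨ λᶠ-exact₂ (Z₁ ∪ Z₂) (Z₁ ∩ Z₂) ⟩
    f (Z₁ ∪ Z₂) + f (Z₁ ∩ Z₂) + (f (∁ (Z₁ ∪ Z₂)) + f (∁ (Z₁ ∩ Z₂)))
      ≡⟨ cong (f (Z₁ ∪ Z₂) + f (Z₁ ∩ Z₂) +_) de-Morgan ⟩
    f (Z₁ ∪ Z₂) + f (Z₁ ∩ Z₂) + (f (∁ Z₁ ∪ ∁ Z₂) + f (∁ Z₁ ∩ ∁ Z₂))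
      ∎
    where
    open ≡-Reasoning
    de-Morgan : f (∁ (Z₁ ∪ Z₂)) + f (∁ (Z₁ ∩ Z₂)) ≡ f (∁ Z₁ ∪ ∁ Z₂) + f (∁ Z₁ ∩ ∁ Z₂)
    de-Morgan = trans (cong₂ (λ U V → f U + f V) (deMorgan₂ Z₁ Z₂) (deMorgan₁ Z₁ Z₂))
                      (+-comm (f (∁ Z₁ ∩ ∁ Z₂)) (f (∁ Z₁ ∪ ∁ Z₂)))

  λᶠ-submodular : ∀ Z₁ Z₂ → λᶠ (Z₁ ∪ Z₂) + λᶠ (Z₁ ∩ Z₂) ≤ λᶠ Z₁ + λᶠ Z₂
  λᶠ-submodular Z₁ Z₂ = +-cancelʳ-≤ (f ⊤ + f ⊤) _ _ (begin
    λᶠ (Z₁ ∪ Z₂) + λᶠ (Z₁ ∩ Z₂) + (f ⊤ + f ⊤)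
      ≡⟨ λᶠ-exact-∪∩ Z₁ Z₂ ⟩
    f (Z₁ ∪ Z₂) + f (Z₁ ∩ Z₂) + (f (∁ Z₁ ∪ ∁ Z₂) + f (∁ Z₁ ∩ ∁ Z₂))
      ≤⟨ +-mono-≤ (f-submod Z₁ Z₂) (f-submod (∁ Z₁) (∁ Z₂)) ⟩
    f Z₁ + f Z₂ + (f (∁ Z₁) + f (∁ Z₂))
      ≡⟨ λᶠ-exact₂ Z₁ Z₂ ⟨
    λᶠ Z₁ + λᶠ Z₂ + (f ⊤ + f ⊤)
      ∎)
    where open ≤-Reasoning

  λᶠ-modular⇒modular : ∀ Z₁ Z₂ → λᶠ Z₁ + λᶠ Z₂ ≤ λᶠ (Z₁ ∪ Z₂) + λᶠ (Z₁ ∩ Z₂) →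
                       Modular Z₁ Z₂ × Modular (∁ Z₁) (∁ Z₂)
  λᶠ-modular⇒modular Z₁ Z₂ λ-le
    with tight-sum (f-submod Z₁ Z₂) (f-submod (∁ Z₁) (∁ Z₂)) (begin
      f Z₁ + f Z₂ + (f (∁ Z₁) + f (∁ Z₂))
        ≡⟨ λᶠ-exact₂ Z₁ Z₂ ⟨
      λᶠ Z₁ + λᶠ Z₂ + (f ⊤ + f ⊤)
        ≤⟨ +-monoˡ-≤ (f ⊤ + f ⊤) λ-le ⟩
      λᶠ (Z₁ ∪ Z₂) + λᶠ (Z₁ ∩ Z₂) + (f ⊤ + f ⊤)
        ≡⟨ λᶠ-exact-∪∩ Z₁ Z₂ ⟩
      f (Z₁ ∪ Z₂) + f (Z₁ ∩ Z₂) + (f (∁ Z₁ ∪ ∁ Z₂) + f (∁ Z₁ ∩ ∁ Z₂))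
        ∎)
    where open ≤-Reasoning
  ... | mod , mod-∁ = sym mod , sym mod-∁

  record Uncrossed (Z₁ Z₂ : Subset k) (c : ℕ) : Set where
    field
      λᶠ-∪      : λᶠ (Z₁ ∪ Z₂) ≡ c
      λᶠ-∩      : λᶠ (Z₁ ∩ Z₂) ≡ c
      modular   : Modular Z₁ Z₂
      modular-∁ : Modular (∁ Z₁) (∁ Z₂)

  uncross : ∀ Z₁ Z₂ {c} → λᶠ Z₁ ≡ c → λᶠ Z₂ ≡ c →
            c ≤ λᶠ (Z₁ ∪ Z₂) → c ≤ λᶠ (Z₁ ∩ Z₂) → Uncrossed Z₁ Z₂ c
  uncross Z₁ Z₂ λ₁ λ₂ c≤∪ c≤∩
    with tight-sum c≤∪ c≤∩ (subst₂ (λ a b → λᶠ (Z₁ ∪ Z₂) + λᶠ (Z₁ ∩ Z₂) ≤ a + b) λ₁ λ₂ (λᶠ-submodular Z₁ Z₂))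
  ... | c≡∪ , c≡∩
    with λᶠ-modular⇒modular Z₁ Z₂ (subst₂ (λ a b → λᶠ Z₁ + λᶠ Z₂ ≤ a + b) (trans λ₁ c≡∪) (trans λ₂ c≡∩) ≤-refl)
  ...   | mod , mod-∁ = record { λᶠ-∪ = sym c≡∪ ; λᶠ-∩ = sym c≡∩ ; modular = mod ; modular-∁ = mod-∁ }

  ⊓ᶠ-λᶠ-exchange : ∀ A Z B → ∁ (A ∪ Z) ≡ B → A ∪ B ≡ ∁ Z → ⊓ᶠ A Z + λᶠ (A ∪ Z) ≡ ⊓ᶠ A B + λᶠ Z
  ⊓ᶠ-λᶠ-exchange A Z .(∁ (A ∪ Z)) refl A∪B≡∁Z = +-cancelʳ-≡ (w + T + u) _ _ (begin
    ⊓ᶠ A Z + λᶠ (A ∪ Z) + (w + T + u)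
      ≡⟨ solve 5 (λ p l w t u → p :+ l :+ (w :+ t :+ u) := p :+ w :+ (l :+ t) :+ u)
                 refl (⊓ᶠ A Z) (λᶠ (A ∪ Z)) w T u ⟩
    ⊓ᶠ A Z + w + (λᶠ (A ∪ Z) + T) + u
      ≡⟨ cong₂ (λ s t → s + t + u) (⊓ᶠ-exact A Z) (λᶠ-exact (A ∪ Z)) ⟩
    f A + f Z + (w + v) + u
      ≡⟨ solve 5 (λ a z w v u → a :+ z :+ (w :+ v) :+ u := a :+ v :+ (z :+ u) :+ w)
                 refl (f A) (f Z) w v u ⟩
    f A + v + (f Z + u) + w
      ≡⟨ cong₂ (λ s t → s + t + w) ⊓AB-exact (λᶠ-exact Z) ⟨
    ⊓ᶠ A B + u + (λᶠ Z + T) + w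
      ≡⟨ solve 5 (λ p l w t u → p :+ u :+ (l :+ t) :+ w := p :+ l :+ (w :+ t :+ u))
                 refl (⊓ᶠ A B) (λᶠ Z) w T u ⟩
    ⊓ᶠ A B + λᶠ Z + (w + T + u)
      ∎)
    where
    open ≡-Reasoning
    B = ∁ (A ∪ Z)
    w = f (A ∪ Z)
    v = f B
    u = f (∁ Z)
    T = f ⊤
    ⊓AB-exact : ⊓ᶠ A B + u ≡ f A + v
    ⊓AB-exact = trans (cong (λ S → ⊓ᶠ A B + f S) (sym A∪B≡∁Z)) (⊓ᶠ-exact A B)

-- Dual local connectivity

module _ {m : ℕ} (M : Matroid m) where
  open Matroid M
  open Connectivity r r-mono r-submod
  open import Algebra.Lattice.Properties.BooleanAlgebra (∪-∩-booleanAlgebra m) using (deMorgan₁; deMorgan₂; ¬⊥≈⊤)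

  r*-exact : ∀ X → r* M X + rM M ≡ ∣ X ∣ + r (∁ X)
  r*-exact X = m∸n+n≡m (≤-trans (subst (λ Z → r Z ≤ r X + r (∁ X)) (p∪∁p≡⊤ X) (f-subadditive X (∁ X)))
                                (+-monoˡ-≤ (r (∁ X)) (r-bounded X)))

  r*-∪-exact : ∀ {X Y} → Disjoint X Y → r* M (X ∪ Y) + rM M ≡ ∣ X ∣ + ∣ Y ∣ + r (∁ (X ∪ Y))
  r*-∪-exact {X} {Y} X∩Y≡⊥ = trans (r*-exact (X ∪ Y)) (cong (_+ r (∁ (X ∪ Y))) (∣∪∣-disjoint X Y X∩Y≡⊥))

  ∁-submod : ∀ {X Y} → Disjoint X Y → r (∁ (X ∪ Y)) + rM M ≤ r (∁ X) + r (∁ Y)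
  ∁-submod {X} {Y} X∩Y≡⊥ =
    subst₂ (λ A B → r B + r A ≤ r (∁ X) + r (∁ Y))
           (trans (sym (deMorgan₁ X Y)) (trans (cong ∁ X∩Y≡⊥) ¬⊥≈⊤)) (sym (deMorgan₂ X Y))
           (subst (_≤ r (∁ X) + r (∁ Y)) (+-comm (r (∁ X ∪ ∁ Y)) (r (∁ X ∩ ∁ Y))) (r-submod (∁ X) (∁ Y)))

  r*-subadditive : ∀ {X Y} → Disjoint X Y → r* M (X ∪ Y) ≤ r* M X + r* M Y
  r*-subadditive {X} {Y} X∩Y≡⊥ = +-cancelʳ-≤ (T + T) _ _ (begin
    r* M (X ∪ Y) + (T + T)                 ≡⟨ sym (+-assoc (r* M (X ∪ Y)) T T) ⟩
    r* M (X ∪ Y) + T + T                   ≡⟨ cong (_+ T) (r*-∪-exact X∩Y≡⊥) ⟩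
    ∣ X ∣ + ∣ Y ∣ + r (∁ (X ∪ Y)) + T      ≡⟨ +-assoc (∣ X ∣ + ∣ Y ∣) _ T ⟩
    ∣ X ∣ + ∣ Y ∣ + (r (∁ (X ∪ Y)) + T)    ≤⟨ +-monoʳ-≤ (∣ X ∣ + ∣ Y ∣) (∁-submod X∩Y≡⊥) ⟩
    ∣ X ∣ + ∣ Y ∣ + (r (∁ X) + r (∁ Y))    ≡⟨ interchange ∣ X ∣ ∣ Y ∣ (r (∁ X)) (r (∁ Y)) ⟩
    ∣ X ∣ + r (∁ X) + (∣ Y ∣ + r (∁ Y))    ≡⟨ cong₂ _+_ (r*-exact X) (r*-exact Y) ⟨
    r* M X + T + (r* M Y + T)              ≡⟨ interchange (r* M X) T (r* M Y) T ⟩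
    r* M X + r* M Y + (T + T)              ∎)
    where
    open ≤-Reasoning
    T = rM M

  ⊓*-exact : ∀ {X Y} → Disjoint X Y → ⊓* M X Y + r (∁ (X ∪ Y)) + rM M ≡ r (∁ X) + r (∁ Y)
  ⊓*-exact {X} {Y} X∩Y≡⊥ = +-cancelʳ-≡ (a + b) _ _ (begin
    ⊓* M X Y + w + T + (a + b)
      ≡⟨ solve 5 (λ d w t a b → d :+ w :+ t :+ (a :+ b) := d :+ (a :+ b :+ w) :+ t) refl (⊓* M X Y) w T a b ⟩
    ⊓* M X Y + (a + b + w) + T
      ≡⟨ cong (λ s → ⊓* M X Y + s + T) (r*-∪-exact X∩Y≡⊥) ⟨
    ⊓* M X Y + (r* M (X ∪ Y) + T) + T
      ≡⟨ solve 4 (λ d s t t′ → d :+ (s :+ t) :+ t′ := d :+ s :+ (t :+ t′)) refl (⊓* M X Y) (r* M (X ∪ Y)) T T ⟩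
    ⊓* M X Y + r* M (X ∪ Y) + (T + T)
      ≡⟨ cong (_+ (T + T)) (m∸n+n≡m (r*-subadditive X∩Y≡⊥)) ⟩
    r* M X + r* M Y + (T + T)
      ≡⟨ interchange (r* M X) (r* M Y) T T ⟩
    r* M X + T + (r* M Y + T)
      ≡⟨ cong₂ _+_ (r*-exact X) (r*-exact Y) ⟩
    a + u + (b + v)
      ≡⟨ solve 4 (λ a u b v → a :+ u :+ (b :+ v) := u :+ v :+ (a :+ b)) refl a u b v ⟩
    u + v + (a + b)
      ∎)
    where
    open ≡-Reasoning
    a = ∣ X ∣
    b = ∣ Y ∣
    u = r (∁ X)
    v = r (∁ Y)
    w = r (∁ (X ∪ Y))
    T = rM M

  ⊓+⊓*≡λ : ∀ {X Y} → Disjoint X Y → ⊓ M X (∁ (X ∪ Y)) + ⊓* M X Y ≡ λM M X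
  ⊓+⊓*≡λ {X} {Y} X∩Y≡⊥ = +-cancelʳ-≡ (v + w + T) _ _ (begin
    ⊓ M X B + ⊓* M X Y + (v + w + T)
      ≡⟨ solve 5 (λ p d v w t → p :+ d :+ (v :+ w :+ t) := p :+ v :+ (d :+ w :+ t)) refl (⊓ M X B) (⊓* M X Y) v w T ⟩
    ⊓ M X B + v + (⊓* M X Y + w + T)
      ≡⟨ cong₂ _+_ ⊓XB-exact (⊓*-exact X∩Y≡⊥) ⟩
    r X + w + (u + v)
      ≡⟨ solve 4 (λ x w u v → x :+ w :+ (u :+ v) := x :+ u :+ v :+ w) refl (r X) w u v ⟩
    r X + u + v + w
      ≡⟨ cong (λ s → s + v + w) (λᶠ-exact X) ⟨
    λM M X + T + v + w
      ≡⟨ solve 4 (λ l t v w → l :+ t :+ v :+ w := l :+ (v :+ w :+ t)) refl (λM M X) T v w ⟩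
    λM M X + (v + w + T)
      ∎)
    where
    open ≡-Reasoning
    B = ∁ (X ∪ Y)
    u = r (∁ X)
    v = r (∁ Y)
    w = r B
    T = rM M
    ⊓XB-exact : ⊓ M X B + v ≡ r X + w
    ⊓XB-exact = trans (cong (λ Z → ⊓ M X B + r Z) (sym (∪-∁∪-disjoint X∩Y≡⊥))) (⊓ᶠ-exact X B)

-- Ordered partitions and flexipaths

data PartOf {m n} (L : Subset m) (Q : Fin n → Subset m) (R : Subset m) (x : Fin m) : Set where
  in-L : x ∈ L → PartOf L Q R x
  in-Q : ∀ t → x ∈ Q t → PartOf L Q R x
  in-R : x ∈ R → PartOf L Q R x

module OrderedPartition {m n} {L R : Subset m} {Q : Fin n → Subset m}
                        (part : IsOrderedPartition L Q R) where

  L∩R : Disjoint L R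
  L∩R = proj₁ part

  L∩Q : ∀ t → Disjoint L (Q t)
  L∩Q = proj₁ (proj₂ part)

  Q∩R : ∀ t → Disjoint (Q t) R
  Q∩R = proj₁ (proj₂ (proj₂ part))

  Q∩Q : ∀ s t → s ≢ t → Disjoint (Q s) (Q t)
  Q∩Q = proj₁ (proj₂ (proj₂ (proj₂ part)))

  Q-unique : ∀ {x s t} → x ∈ Q s → x ∈ Q t → s ≡ t
  Q-unique {s = s} {t} x∈Qs x∈Qt with s ≟ t
  ... | yes s≡t = s≡t
  ... | no  s≢t = ⊥-elim (disjoint⇒∉ (Q∩Q s t s≢t) x∈Qs x∈Qt)

  partOf : ∀ x → PartOf L Q R x
  partOf x with x∈p∪q⁻ L _ (subst (x ∈_) (sym (proj₂ (proj₂ (proj₂ (proj₂ part))))) ∈⊤)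
  ... | inj₁ x∈L = in-L x∈L
  ... | inj₂ x∈QR with x∈p∪q⁻ (⋃ (map Q (allFin n))) R x∈QR
  ...   | inj₂ x∈R = in-R x∈R
  ...   | inj₁ x∈Q with Any.tabulate⁻ (subst (Any (x ∈_)) (map-tabulate (λ t → t) Q) (∈-⋃⁻ _ x∈Q))
  ...     | t , x∈Qt = in-Q t x∈Qt

  ∈-prefixUnion⁻ : ∀ {x} σ k → x ∈ prefixUnion L Q σ k → x ∈ L ⊎ ∃[ j ] toℕ j < k × x ∈ Q (σ ⟨$⟩ʳ j)
  ∈-prefixUnion⁻ σ k x∈ with x∈p∪q⁻ L _ x∈
  ... | inj₁ x∈L = inj₁ x∈L
  ... | inj₂ x∈Q = inj₂ (∈-⋃-take⁻ (λ j → Q (σ ⟨$⟩ʳ j)) k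
                     (subst (λ ps → _ ∈ ⋃ (take k ps)) (map-tabulate (λ j → j) (λ j → Q (σ ⟨$⟩ʳ j))) x∈Q))

  ∈-prefixUnion⁺ : ∀ {x} σ k j → toℕ j < k → x ∈ Q (σ ⟨$⟩ʳ j) → x ∈ prefixUnion L Q σ k
  ∈-prefixUnion⁺ σ k j j<k x∈ = x∈p∪q⁺ (inj₂ (subst (λ ps → _ ∈ ⋃ (take k ps))
    (sym (map-tabulate (λ j → j) (λ j → Q (σ ⟨$⟩ʳ j)))) (∈-⋃-take⁺ (λ j → Q (σ ⟨$⟩ʳ j)) k j j<k x∈)))

transpose-self : ∀ {n} (i j : Fin n) → PC.transpose i j i ≡ j
transpose-self i j rewrite dec-true (i ≟ i) refl = refl

⟨$⟩ʳ-injective : ∀ {n} (π : Permutation′ n) {s t} → π ⟨$⟩ʳ s ≡ π ⟨$⟩ʳ t → s ≡ t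
⟨$⟩ʳ-injective π e = trans (sym (inverseˡ π)) (trans (cong (π ⟨$⟩ˡ_) e) (inverseˡ π))

module _ {m n} {L R : Subset m} {Q : Fin (suc n) → Subset m} (part : IsOrderedPartition L Q R) where
  open OrderedPartition part

  prefixUnion-transpose-last : ∀ t → prefixUnion L Q (transpose (fromℕ n) t) n ≡ ∁ (R ∪ Q t)
  prefixUnion-transpose-last t = ⊆-antisym prefix⊆ ⊆prefix
    where
    σ = transpose (fromℕ n) t

    σ≡t⇔last : ∀ j → σ ⟨$⟩ʳ j ≡ t ⇔ toℕ j ≡ n
    σ≡t⇔last j = mk⇔
      (λ σj≡t → trans (cong toℕ (trans (sym (inverseˡ σ)) (trans (cong (σ ⟨$⟩ˡ_) σj≡t) (transpose-self t (fromℕ n)))))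
                      (toℕ-fromℕ n))
      (λ j≡n → trans (cong (σ ⟨$⟩ʳ_) (toℕ-injective (trans j≡n (sym (toℕ-fromℕ n))))) (transpose-self (fromℕ n) t))

    prefix⊆ : prefixUnion L Q σ n ⊆ ∁ (R ∪ Q t)
    prefix⊆ {x} x∈ = x∉p⇒x∈∁p (λ x∈R∪Q → [ outside-R , outside-Q ]′ (x∈p∪q⁻ R (Q t) x∈R∪Q))
      where
      outside-R : x ∉ R
      outside-R = [ disjoint⇒∉ L∩R , (λ (j , _ , x∈Q) → disjoint⇒∉ (Q∩R _) x∈Q) ]′ (∈-prefixUnion⁻ σ n x∈)
      outside-Q : x ∉ Q t
      outside-Q x∈Qt =
        [ (λ x∈L → disjoint⇒∉ (L∩Q t) x∈L x∈Qt)
        , (λ (j , j<n , x∈Q) → <⇒≢ j<n (Equivalence.to (σ≡t⇔last j) (Q-unique x∈Q x∈Qt))) ]′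
        (∈-prefixUnion⁻ σ n x∈)

    ⊆prefix : ∁ (R ∪ Q t) ⊆ prefixUnion L Q σ n
    ⊆prefix {x} x∈∁ with partOf x
    ... | in-L x∈L    = x∈p∪q⁺ (inj₁ x∈L)
    ... | in-R x∈R    = ⊥-elim (x∈∁p⇒x∉p x∈∁ (x∈p∪q⁺ (inj₁ x∈R)))
    ... | in-Q s x∈Qs = ∈-prefixUnion⁺ σ n j j<n x∈Qσj
      where
      j = σ ⟨$⟩ˡ s
      x∈Qσj : x ∈ Q (σ ⟨$⟩ʳ j)
      x∈Qσj = subst (λ u → x ∈ Q u) (sym (inverseʳ σ)) x∈Qs
      j<n : toℕ j < n
      j<n = ≤∧≢⇒< (s≤s⁻¹ (toℕ<n j))
              (λ j≡n → x∈∁p⇒x∉p x∈∁ (x∈p∪q⁺ (inj₂ (subst (λ u → x ∈ Q u) (Equivalence.from (σ≡t⇔last j) j≡n) x∈Qσj))))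

module _ {m n} {M : Matroid m} {L R : Subset m} {Q : Fin (suc n) → Subset m} (flexi : Is4Flexipath M L Q R) where
  private
    flex = proj₂ (proj₂ flexi)

  λ-L : λM M L ≡ 3
  λ-L = subst (λ Z → λM M Z ≡ 3) (∪-identityʳ L) (flex Perm.id 0 z≤n)

  λ-L∪Q : ∀ t → λM M (L ∪ Q t) ≡ 3
  λ-L∪Q t = subst (λ Z → λM M (L ∪ Z) ≡ 3) (∪-identityʳ (Q t)) (flex (transpose zero t) 1 (s≤s z≤n))

  λ-∁[R∪Q] : ∀ t → λM M (∁ (R ∪ Q t)) ≡ 3
  λ-∁[R∪Q] t = subst (λ Z → λM M Z ≡ 3) (prefixUnion-transpose-last (proj₁ flexi) t)
                     (flex (transpose (fromℕ n) t) n (n≤1+n n))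

module _ {m n} {M : Matroid m} {L R : Subset m} {Q : Fin n → Subset m} (π : Permutation′ n) where

  relabel-partition : IsOrderedPartition L Q R → IsOrderedPartition L (λ t → Q (π ⟨$⟩ʳ t)) R
  relabel-partition part =
    L∩R , L∩Q ∘ (π ⟨$⟩ʳ_) , Q∩R ∘ (π ⟨$⟩ʳ_) , (λ s t s≢t → Q∩Q _ _ (s≢t ∘ ⟨$⟩ʳ-injective π)) ,
    ⊆-antisym ⊆⊤ (λ {x} _ → covered (partOf x))
    where
    open OrderedPartition part
    covered : ∀ {x} → PartOf L Q R x → x ∈ L ∪ (⋃ (map (λ t → Q (π ⟨$⟩ʳ t)) (allFin n)) ∪ R)
    covered (in-L x∈L)    = x∈p∪q⁺ (inj₁ x∈L)
    covered (in-R x∈R)    = x∈p∪q⁺ (inj₂ (x∈p∪q⁺ (inj₂ x∈R)))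
    covered (in-Q s x∈Qs) = x∈p∪q⁺ (inj₂ (x∈p∪q⁺ (inj₁ (∈-⋃⁺
      (subst (Any (_ ∈_)) (sym (map-tabulate (λ t → t) (λ t → Q (π ⟨$⟩ʳ t))))
             (Any.tabulate⁺ (π ⟨$⟩ˡ s) (subst (λ u → _ ∈ Q u) (sym (inverseʳ π)) x∈Qs)))))))

  relabel : Is42Flexipath M L Q R → Is42Flexipath M L (λ t → Q (π ⟨$⟩ʳ t)) R
  relabel ((part , κ3 , flex) , λQ , λQQ) =
    (relabel-partition part , κ3 , (λ σ → flex (σ ∘ₚ π))) ,
    λQ ∘ (π ⟨$⟩ʳ_) , (λ s t s≢t → λQQ _ _ (s≢t ∘ ⟨$⟩ʳ-injective π))

-- Coarsening a matroid along a map to a small ground set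

module Coarsening {m k : ℕ} (M : Matroid m) (g : Fin m → Fin k) where
  open Matroid M

  ρ : Subset k → ℕ
  ρ c = r (preimage g c)

  ρ-mono : ∀ {c d} → c ⊆ d → ρ c ≤ ρ d
  ρ-mono = r-mono ∘ preimage-mono g

  ρ-submod : ∀ c d → ρ (c ∪ d) + ρ (c ∩ d) ≤ ρ c + ρ d
  ρ-submod c d = subst₂ (λ A B → r A + r B ≤ ρ c + ρ d) (sym (preimage-∪ g c d)) (sym (preimage-∩ g c d))
                        (r-submod (preimage g c) (preimage g d))

  open Connectivity ρ ρ-mono ρ-submod public

  λM-preimage : ∀ c → λM M (preimage g c) ≡ λᶠ c
  λM-preimage c = cong₂ (λ A B → ρ c + r A ∸ r B) (sym (preimage-∁ g c)) (sym (preimage-⊤ g))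

  ⊓-preimage : ∀ c d → ⊓ M (preimage g c) (preimage g d) ≡ ⊓ᶠ c d
  ⊓-preimage c d = cong (λ A → ρ c + ρ d ∸ r A) (sym (preimage-∪ g c d))

-- The ground set is coarsened into seven classes: Q 0, …, Q 3 (classes 0–3), L (4), R (5) and
-- the union of the remaining middle parts (6).  Every set in the argument is a union of classes,
-- so the set identities it needs hold by evaluation on Subset 7; likewise the implicit arguments
-- of type True (X ⊆? Y) below are solved by evaluation.
module FourParts {m n′ : ℕ} (M : Matroid m) (L R : Subset m) (Q : Fin (4 + n′) → Subset m)
                 (flexi : Is42Flexipath M L Q R) (⊓LR≡1 : ⊓ M L R ≡ 1) (⊓*LR≡1 : ⊓* M L R ≡ 1)
                 (⊓LQ≡1 : ∀ t → ⊓ M L (Q t) ≡ 1) where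

  open OrderedPartition (proj₁ (proj₁ flexi))

  cellQ : Fin (4 + n′) → Fin 4 ⊎ Fin 3
  cellQ t = map₂ (λ _ → # 2) (splitAt 4 t)

  cell : ∀ {x} → PartOf L Q R x → Fin 4 ⊎ Fin 3
  cell (in-L _)   = inj₂ (# 0)
  cell (in-R _)   = inj₂ (# 1)
  cell (in-Q t _) = cellQ t

  class : Fin m → Fin 7
  class x = join 4 3 (cell (partOf x))

  open Coarsening M class
  open Uncrossed

  U : Subset 7 → Subset m
  U = preimage class

  block : Fin 4 ⊎ Fin 3 → Subset 7
  block c = ⁅ join 4 3 c ⁆

  𝓛 𝓡 𝓟 : Subset 7
  𝓛 = block (inj₂ (# 0))
  𝓡 = block (inj₂ (# 1))
  𝓟 = ∁ (𝓛 ∪ 𝓡)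

  q : Fin 4 → Subset 7
  q s = block (inj₁ s)

  q₀ q₁ q₂ q₃ : Subset 7
  q₀ = q (# 0)
  q₁ = q (# 1)
  q₂ = q (# 2)
  q₃ = q (# 3)

  U-block : ∀ c {S} → (∀ {x} → x ∈ S ⇔ cell (partOf x) ≡ c) → U (block c) ≡ S
  U-block c {S} spec =
    ⊆-antisym (Equivalence.from spec ∘ in-block) (∈-preimage⁺ class (block c) ∘ cell≡ ∘ Equivalence.to spec)
    where
    in-block : ∀ {x} → x ∈ U (block c) → cell (partOf x) ≡ c
    in-block {x} x∈ = trans (sym (splitAt-join 4 3 (cell (partOf x))))
      (trans (cong (splitAt 4) (x∈⁅y⁆⇒x≡y _ (∈-preimage⁻ class (block c) x∈))) (splitAt-join 4 3 c))
    cell≡ : ∀ {x} → cell (partOf x) ≡ c → class x ∈ block c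
    cell≡ e = subst (λ d → join 4 3 d ∈ block c) (sym e) (x∈⁅x⁆ _)

  rest-cell : ∀ t {c} → cellQ t ≡ inj₂ c → # 2 ≡ c
  rest-cell t with splitAt 4 t
  ... | inj₁ _ = λ ()
  ... | inj₂ _ = inj₂-injective

  U-𝓛 : U 𝓛 ≡ L
  U-𝓛 = U-block _ spec
    where
    spec : ∀ {x} → x ∈ L ⇔ cell (partOf x) ≡ inj₂ (# 0)
    spec {x} with partOf x
    ... | in-L x∈L   = mk⇔ (λ _ → refl) (λ _ → x∈L)
    ... | in-R x∈R   = mk⇔ (λ x∈L → ⊥-elim (disjoint⇒∉ L∩R x∈L x∈R)) (λ ())
    ... | in-Q t x∈Q = mk⇔ (λ x∈L → ⊥-elim (disjoint⇒∉ (L∩Q t) x∈L x∈Q)) (λ e → case rest-cell t e of λ ())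

  U-𝓡 : U 𝓡 ≡ R
  U-𝓡 = U-block _ spec
    where
    spec : ∀ {x} → x ∈ R ⇔ cell (partOf x) ≡ inj₂ (# 1)
    spec {x} with partOf x
    ... | in-L x∈L   = mk⇔ (λ x∈R → ⊥-elim (disjoint⇒∉ L∩R x∈L x∈R)) (λ ())
    ... | in-R x∈R   = mk⇔ (λ _ → refl) (λ _ → x∈R)
    ... | in-Q t x∈Q = mk⇔ (λ x∈R → ⊥-elim (disjoint⇒∉ (Q∩R t) x∈Q x∈R)) (λ e → case rest-cell t e of λ ())

  U-q : ∀ s → U (q s) ≡ Q (s ↑ˡ n′)
  U-q s = U-block _ spec
    where
    part-index : ∀ t → cellQ t ≡ inj₁ s → t ≡ s ↑ˡ n′
    part-index t with splitAt 4 t in eq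
    ... | inj₁ _ = λ { refl → sym (splitAt⁻¹-↑ˡ eq) }
    ... | inj₂ _ = λ ()
    spec : ∀ {x} → x ∈ Q (s ↑ˡ n′) ⇔ cell (partOf x) ≡ inj₁ s
    spec {x} with partOf x
    ... | in-L x∈L    = mk⇔ (λ x∈Q → ⊥-elim (disjoint⇒∉ (L∩Q _) x∈L x∈Q)) (λ ())
    ... | in-R x∈R    = mk⇔ (λ x∈Q → ⊥-elim (disjoint⇒∉ (Q∩R _) x∈Q x∈R)) (λ ())
    ... | in-Q t x∈Qt = mk⇔
      (λ x∈Q → cong (map₂ (λ _ → # 2)) (trans (cong (splitAt 4) (Q-unique x∈Qt x∈Q)) (splitAt-↑ˡ 4 s n′)))
      (λ e → subst (λ u → x ∈ Q u) (part-index t e) x∈Qt)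

  U-q∪q : ∀ s t → U (q s ∪ q t) ≡ Q (s ↑ˡ n′) ∪ Q (t ↑ˡ n′)
  U-q∪q s t = trans (preimage-∪ class (q s) (q t)) (cong₂ _∪_ (U-q s) (U-q t))

  λᶠ-via : ∀ c {Z} → U c ≡ Z → λᶠ c ≡ λM M Z
  λᶠ-via c U≡Z = trans (sym (λM-preimage c)) (cong (λM M) U≡Z)

  ⊓ᶠ-via : ∀ c d {X Y} → U c ≡ X → U d ≡ Y → ⊓ᶠ c d ≡ ⊓ M X Y
  ⊓ᶠ-via c d U≡X U≡Y = trans (sym (⊓-preimage c d)) (cong₂ (⊓ M) U≡X U≡Y)

  ⊓ᶠ-𝓛q : ∀ s → ⊓ᶠ 𝓛 (q s) ≡ 1
  ⊓ᶠ-𝓛q s = trans (⊓ᶠ-via 𝓛 (q s) U-𝓛 (U-q s)) (⊓LQ≡1 (s ↑ˡ n′))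

  ⊓ᶠ-𝓛𝓡 : ⊓ᶠ 𝓛 𝓡 ≡ 1
  ⊓ᶠ-𝓛𝓡 = trans (⊓ᶠ-via 𝓛 𝓡 U-𝓛 U-𝓡) ⊓LR≡1

  ⊓ᶠ-𝓛𝓟 : ⊓ᶠ 𝓛 𝓟 ≡ 2
  ⊓ᶠ-𝓛𝓟 = trans (⊓ᶠ-via 𝓛 𝓟 U-𝓛 U-𝓟) (+-cancelʳ-≡ 1 _ 2 (begin
    ⊓ M L (∁ (L ∪ R)) + 1              ≡⟨ cong (⊓ M L (∁ (L ∪ R)) +_) ⊓*LR≡1 ⟨
    ⊓ M L (∁ (L ∪ R)) + ⊓* M L R       ≡⟨ ⊓+⊓*≡λ M L∩R ⟩
    λM M L                             ≡⟨ λ-L {M = M} (proj₁ flexi) ⟩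
    3                                  ∎))
    where
    open ≡-Reasoning
    U-𝓟 : U 𝓟 ≡ ∁ (L ∪ R)
    U-𝓟 = trans (preimage-∁ class (𝓛 ∪ 𝓡)) (cong ∁ (trans (preimage-∪ class 𝓛 𝓡) (cong₂ _∪_ U-𝓛 U-𝓡)))

  ⊓ᶠ-𝓛[q∪q] : ∀ s t → ⊓ᶠ 𝓛 (q s ∪ q t) ≡ ⊓ M L (Q (s ↑ˡ n′) ∪ Q (t ↑ˡ n′))
  ⊓ᶠ-𝓛[q∪q] s t = ⊓ᶠ-via 𝓛 (q s ∪ q t) U-𝓛 (U-q∪q s t)

  λᶠ-𝓛∪q : ∀ s → λᶠ (𝓛 ∪ q s) ≡ 3
  λᶠ-𝓛∪q s = trans (λᶠ-via (𝓛 ∪ q s) (trans (preimage-∪ class 𝓛 (q s)) (cong₂ _∪_ U-𝓛 (U-q s))))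
                   (λ-L∪Q {M = M} (proj₁ flexi) (s ↑ˡ n′))

  λᶠ-∁[𝓡∪q] : ∀ s → λᶠ (∁ (𝓡 ∪ q s)) ≡ 3
  λᶠ-∁[𝓡∪q] s = trans (λᶠ-via (∁ (𝓡 ∪ q s)) U-∁[𝓡∪q]) (λ-∁[R∪Q] {M = M} (proj₁ flexi) (s ↑ˡ n′))
    where
    U-∁[𝓡∪q] : U (∁ (𝓡 ∪ q s)) ≡ ∁ (R ∪ Q (s ↑ˡ n′))
    U-∁[𝓡∪q] = trans (preimage-∁ class (𝓡 ∪ q s)) (cong ∁ (trans (preimage-∪ class 𝓡 (q s)) (cong₂ _∪_ U-𝓡 (U-q s))))

  λᶠ-q : ∀ s → λᶠ (q s) ≡ 2
  λᶠ-q s = trans (λᶠ-via (q s) (U-q s)) (proj₁ (proj₂ flexi) (s ↑ˡ n′))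

  λᶠ-q∪q : ∀ s t → s ≢ t → 3 ≤ λᶠ (q s ∪ q t)
  λᶠ-q∪q s t s≢t = subst (3 ≤_) (sym (λᶠ-via (q s ∪ q t) (U-q∪q s t)))
                         (proj₂ (proj₂ flexi) (s ↑ˡ n′) (t ↑ˡ n′) (s≢t ∘ ↑ˡ-injective n′ s t))

  κ-𝓛𝓡 : ∀ c {_ : True (𝓛 ⊆? c)} {_ : True (c ⊆? ∁ 𝓡)} → 3 ≤ λᶠ c
  κ-𝓛𝓡 c {𝓛⊆c} {c⊆∁𝓡} = subst (3 ≤_) (λM-preimage c)
    (proj₂ (proj₁ (proj₂ (proj₁ flexi))) (U c)
      (subst (_⊆ U c) U-𝓛 (preimage-mono class (toWitness 𝓛⊆c)))
      (subst (U c ⊆_) (trans (preimage-∁ class 𝓡) (cong ∁ U-𝓡)) (preimage-mono class (toWitness c⊆∁𝓡))))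

  ⊓ᶠ-𝓛-mono : ∀ X Y {_ : True (X ⊆? Y)} → ⊓ᶠ 𝓛 X ≤ ⊓ᶠ 𝓛 Y
  ⊓ᶠ-𝓛-mono X Y {X⊆Y} = ⊓ᶠ-monoʳ 𝓛 X Y (toWitness X⊆Y)

  uncross₃ : ∀ Z₁ Z₂ → λᶠ Z₁ ≡ 3 → λᶠ Z₂ ≡ 3 →
             {_ : True (𝓛 ⊆? Z₁ ∪ Z₂)} {_ : True (Z₁ ∪ Z₂ ⊆? ∁ 𝓡)}
             {_ : True (𝓛 ⊆? Z₁ ∩ Z₂)} {_ : True (Z₁ ∩ Z₂ ⊆? ∁ 𝓡)} → Uncrossed Z₁ Z₂ 3
  uncross₃ Z₁ Z₂ λ₁ λ₂ {a} {b} {c} {d} =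
    uncross Z₁ Z₂ λ₁ λ₂ (κ-𝓛𝓡 (Z₁ ∪ Z₂) {a} {b}) (κ-𝓛𝓡 (Z₁ ∩ Z₂) {c} {d})

  ⊓ᶠ-𝓛∁[𝓛∪q∪q] : ∀ s t → s ≢ t → 𝓛 ∪ ∁ (𝓛 ∪ q s ∪ q t) ≡ ∁ (q s ∪ q t) → λᶠ (𝓛 ∪ q s ∪ q t) ≡ 3 →
                  ⊓ᶠ 𝓛 (∁ (𝓛 ∪ q s ∪ q t)) ≤ ⊓ᶠ 𝓛 (q s ∪ q t)
  ⊓ᶠ-𝓛∁[𝓛∪q∪q] s t s≢t partition λ₃ = +-cancelʳ-≤ 3 _ _ (begin
    ⊓ᶠ 𝓛 (∁ (𝓛 ∪ Z)) + 3        ≤⟨ +-monoʳ-≤ (⊓ᶠ 𝓛 (∁ (𝓛 ∪ Z))) (λᶠ-q∪q s t s≢t) ⟩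
    ⊓ᶠ 𝓛 (∁ (𝓛 ∪ Z)) + λᶠ Z     ≡⟨ ⊓ᶠ-λᶠ-exchange 𝓛 Z (∁ (𝓛 ∪ Z)) refl partition ⟨
    ⊓ᶠ 𝓛 Z + λᶠ (𝓛 ∪ Z)         ≡⟨ cong (⊓ᶠ 𝓛 Z +_) λ₃ ⟩
    ⊓ᶠ 𝓛 Z + 3                  ∎)
    where
    open ≤-Reasoning
    Z = q s ∪ q t

  ⊓ᶠ-𝓛∁[𝓛∪q₃] : ⊓ᶠ 𝓛 (∁ (𝓛 ∪ q₃)) ≡ 2
  ⊓ᶠ-𝓛∁[𝓛∪q₃] = +-cancelʳ-≡ 2 _ 2 (begin
    ⊓ᶠ 𝓛 (∁ (𝓛 ∪ q₃)) + 2        ≡⟨ cong (⊓ᶠ 𝓛 (∁ (𝓛 ∪ q₃)) +_) (λᶠ-q (# 3)) ⟨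
    ⊓ᶠ 𝓛 (∁ (𝓛 ∪ q₃)) + λᶠ q₃    ≡⟨ ⊓ᶠ-λᶠ-exchange 𝓛 q₃ (∁ (𝓛 ∪ q₃)) refl refl ⟨
    ⊓ᶠ 𝓛 q₃ + λᶠ (𝓛 ∪ q₃)        ≡⟨ cong₂ _+_ (⊓ᶠ-𝓛q (# 3)) (λᶠ-𝓛∪q (# 3)) ⟩
    4                            ∎)
    where open ≡-Reasoning

  λᶠ-𝓛∪q₀∪q₁ : λᶠ (𝓛 ∪ q₀ ∪ q₁) ≡ 3
  λᶠ-𝓛∪q₀∪q₁ = λᶠ-∪ (uncross₃ (𝓛 ∪ q₀) (𝓛 ∪ q₁) (λᶠ-𝓛∪q (# 0)) (λᶠ-𝓛∪q (# 1)))

  λᶠ-𝓛∪q₀∪q₂ : λᶠ (𝓛 ∪ q₀ ∪ q₂) ≡ 3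
  λᶠ-𝓛∪q₀∪q₂ = λᶠ-∪ (uncross₃ (𝓛 ∪ q₀) (𝓛 ∪ q₂) (λᶠ-𝓛∪q (# 0)) (λᶠ-𝓛∪q (# 2)))

  λᶠ-𝓛∪q₁∪q₂ : λᶠ (𝓛 ∪ q₁ ∪ q₂) ≡ 3
  λᶠ-𝓛∪q₁∪q₂ = λᶠ-∪ (uncross₃ (𝓛 ∪ q₁) (𝓛 ∪ q₂) (λᶠ-𝓛∪q (# 1)) (λᶠ-𝓛∪q (# 2)))

  λᶠ-𝓛∪q₀∪q₁∪q₂ : λᶠ (𝓛 ∪ q₀ ∪ q₁ ∪ q₂) ≡ 3
  λᶠ-𝓛∪q₀∪q₁∪q₂ = λᶠ-∪ (uncross₃ (𝓛 ∪ q₀ ∪ q₁) (𝓛 ∪ q₂) λᶠ-𝓛∪q₀∪q₁ (λᶠ-𝓛∪q (# 2)))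

  λᶠ-∁[𝓡∪q₀∪q₁] : λᶠ (∁ (𝓡 ∪ q₀ ∪ q₁)) ≡ 3
  λᶠ-∁[𝓡∪q₀∪q₁] = λᶠ-∩ (uncross₃ (∁ (𝓡 ∪ q₀)) (∁ (𝓡 ∪ q₁)) (λᶠ-∁[𝓡∪q] (# 0)) (λᶠ-∁[𝓡∪q] (# 1)))

  λᶠ-∁[𝓡∪q₀∪q₂] : λᶠ (∁ (𝓡 ∪ q₀ ∪ q₂)) ≡ 3
  λᶠ-∁[𝓡∪q₀∪q₂] = λᶠ-∩ (uncross₃ (∁ (𝓡 ∪ q₀)) (∁ (𝓡 ∪ q₂)) (λᶠ-∁[𝓡∪q] (# 0)) (λᶠ-∁[𝓡∪q] (# 2)))

  λᶠ-∁[𝓡∪q₁∪q₂] : λᶠ (∁ (𝓡 ∪ q₁ ∪ q₂)) ≡ 3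
  λᶠ-∁[𝓡∪q₁∪q₂] = λᶠ-∩ (uncross₃ (∁ (𝓡 ∪ q₁)) (∁ (𝓡 ∪ q₂)) (λᶠ-∁[𝓡∪q] (# 1)) (λᶠ-∁[𝓡∪q] (# 2)))

  no-two-low-pairs : ¬ (⊓ M L (Q (# 0) ∪ Q (# 1)) ≤ 1 × ⊓ M L (Q (# 0) ∪ Q (# 2)) ≤ 1)
  no-two-low-pairs (h₀₁ , h₀₂) = 1+n≰n (subst (_≤ 1) ⊓ᶠ-𝓛𝓟
    (balance-≤ [q₀∪q₁]≤1 [𝓟─q₀]≤1
      (⊓ᶠ-submodular 𝓛 (q₀ ∪ q₁) (𝓟 ─ q₀)
        (modular (uncross₃ (𝓛 ∪ q₀ ∪ q₁) (∁ (𝓡 ∪ q₀)) λᶠ-𝓛∪q₀∪q₁ (λᶠ-∁[𝓡∪q] (# 0)))))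
      (≤-reflexive (sym (⊓ᶠ-𝓛q (# 1))))))
    where
    [q₀∪q₁]≤1 : ⊓ᶠ 𝓛 (q₀ ∪ q₁) ≤ 1
    [q₀∪q₁]≤1 = subst (_≤ 1) (sym (⊓ᶠ-𝓛[q∪q] (# 0) (# 1))) h₀₁
    [q₀∪q₂]≤1 : ⊓ᶠ 𝓛 (q₀ ∪ q₂) ≤ 1
    [q₀∪q₂]≤1 = subst (_≤ 1) (sym (⊓ᶠ-𝓛[q∪q] (# 0) (# 2))) h₀₂
    [𝓟─q₀─q₁]≤1 : ⊓ᶠ 𝓛 (𝓟 ─ (q₀ ∪ q₁)) ≤ 1
    [𝓟─q₀─q₁]≤1 = ≤-trans (⊓ᶠ-𝓛-mono (𝓟 ─ (q₀ ∪ q₁)) (∁ (𝓛 ∪ q₀ ∪ q₁)))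
                    (≤-trans (⊓ᶠ-𝓛∁[𝓛∪q∪q] (# 0) (# 1) (λ ()) refl λᶠ-𝓛∪q₀∪q₁) [q₀∪q₁]≤1)
    [𝓟─q₀─q₂]≤1 : ⊓ᶠ 𝓛 (𝓟 ─ (q₀ ∪ q₂)) ≤ 1
    [𝓟─q₀─q₂]≤1 = ≤-trans (⊓ᶠ-𝓛-mono (𝓟 ─ (q₀ ∪ q₂)) (∁ (𝓛 ∪ q₀ ∪ q₂)))
                    (≤-trans (⊓ᶠ-𝓛∁[𝓛∪q∪q] (# 0) (# 2) (λ ()) refl λᶠ-𝓛∪q₀∪q₂) [q₀∪q₂]≤1)
    [𝓟─q₀]≤1 : ⊓ᶠ 𝓛 (𝓟 ─ q₀) ≤ 1
    [𝓟─q₀]≤1 = balance-≤ [𝓟─q₀─q₁]≤1 [𝓟─q₀─q₂]≤1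
      (⊓ᶠ-submodular 𝓛 (𝓟 ─ (q₀ ∪ q₁)) (𝓟 ─ (q₀ ∪ q₂))
        (modular (uncross₃ (∁ (𝓡 ∪ q₀ ∪ q₁)) (∁ (𝓡 ∪ q₀ ∪ q₂)) λᶠ-∁[𝓡∪q₀∪q₁] λᶠ-∁[𝓡∪q₀∪q₂])))
      (≤-trans (≤-reflexive (sym (⊓ᶠ-𝓛q (# 3)))) (⊓ᶠ-𝓛-mono q₃ (𝓟 ─ (q₀ ∪ q₁ ∪ q₂))))

  no-two-high-pairs : ¬ (2 ≤ ⊓ M L (Q (# 0) ∪ Q (# 1)) × 2 ≤ ⊓ M L (Q (# 0) ∪ Q (# 2)))
  no-two-high-pairs (h₀₁ , h₀₂) = 1+n≰n (subst (2 ≤_) ⊓ᶠ-𝓛𝓡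
    (balance-≥ [𝓡∪q₀]≥2 [𝓡∪q₁]≥2
      (⊓ᶠ-supermodular 𝓛 (𝓡 ∪ q₀) (𝓡 ∪ q₁)
        (modular-∁ (uncross₃ (∁ (𝓡 ∪ q₀)) (∁ (𝓡 ∪ q₁)) (λᶠ-∁[𝓡∪q] (# 0)) (λᶠ-∁[𝓡∪q] (# 1)))))
      (≤-trans (⊓ᶠ-𝓛-mono (𝓡 ∪ q₀ ∪ q₁) (𝓡 ∪ q₀ ∪ q₁ ∪ q₂)) [𝓡∪q₀∪q₁∪q₂]≤2)))
    where
    [𝓡∪q₀∪q₁∪q₂]≤2 : ⊓ᶠ 𝓛 (𝓡 ∪ q₀ ∪ q₁ ∪ q₂) ≤ 2
    [𝓡∪q₀∪q₁∪q₂]≤2 = ≤-trans (⊓ᶠ-𝓛-mono (𝓡 ∪ q₀ ∪ q₁ ∪ q₂) (∁ (𝓛 ∪ q₃))) (≤-reflexive ⊓ᶠ-𝓛∁[𝓛∪q₃])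
    [𝓡∪q₀∪q₁]≥2 : 2 ≤ ⊓ᶠ 𝓛 (𝓡 ∪ q₀ ∪ q₁)
    [𝓡∪q₀∪q₁]≥2 = ≤-trans (subst (2 ≤_) (sym (⊓ᶠ-𝓛[q∪q] (# 0) (# 1))) h₀₁)
                          (⊓ᶠ-𝓛-mono (q₀ ∪ q₁) (𝓡 ∪ q₀ ∪ q₁))
    [𝓡∪q₀∪q₂]≥2 : 2 ≤ ⊓ᶠ 𝓛 (𝓡 ∪ q₀ ∪ q₂)
    [𝓡∪q₀∪q₂]≥2 = ≤-trans (subst (2 ≤_) (sym (⊓ᶠ-𝓛[q∪q] (# 0) (# 2))) h₀₂)
                          (⊓ᶠ-𝓛-mono (q₀ ∪ q₂) (𝓡 ∪ q₀ ∪ q₂))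
    [𝓡∪q₀]≥2 : 2 ≤ ⊓ᶠ 𝓛 (𝓡 ∪ q₀)
    [𝓡∪q₀]≥2 = balance-≥ [𝓡∪q₀∪q₁]≥2 [𝓡∪q₀∪q₂]≥2
      (⊓ᶠ-supermodular 𝓛 (𝓡 ∪ q₀ ∪ q₁) (𝓡 ∪ q₀ ∪ q₂)
        (modular-∁ (uncross₃ (∁ (𝓡 ∪ q₀ ∪ q₁)) (∁ (𝓡 ∪ q₀ ∪ q₂)) λᶠ-∁[𝓡∪q₀∪q₁] λᶠ-∁[𝓡∪q₀∪q₂])))
      [𝓡∪q₀∪q₁∪q₂]≤2
    ∁[𝓛∪q₁∪q₂]≥2 : 2 ≤ ⊓ᶠ 𝓛 (∁ (𝓛 ∪ q₁ ∪ q₂))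
    ∁[𝓛∪q₁∪q₂]≥2 = +-cancelʳ-≤ 1 2 _ (begin
      2 + 1
        ≤⟨ +-mono-≤ [𝓡∪q₀]≥2 (≤-trans (≤-reflexive (sym ⊓ᶠ-𝓛𝓡)) (⊓ᶠ-𝓛-mono 𝓡 (𝓡 ∪ rest))) ⟩
      ⊓ᶠ 𝓛 (𝓡 ∪ q₀) + ⊓ᶠ 𝓛 (𝓡 ∪ rest)
        ≤⟨ ⊓ᶠ-supermodular 𝓛 (𝓡 ∪ q₀) (𝓡 ∪ rest)
             (modular-∁ (uncross₃ (∁ (𝓡 ∪ q₀)) (𝓛 ∪ q₀ ∪ q₁ ∪ q₂) (λᶠ-∁[𝓡∪q] (# 0)) λᶠ-𝓛∪q₀∪q₁∪q₂)) ⟩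
      ⊓ᶠ 𝓛 (∁ (𝓛 ∪ q₁ ∪ q₂)) + ⊓ᶠ 𝓛 𝓡
        ≡⟨ cong (⊓ᶠ 𝓛 (∁ (𝓛 ∪ q₁ ∪ q₂)) +_) ⊓ᶠ-𝓛𝓡 ⟩
      ⊓ᶠ 𝓛 (∁ (𝓛 ∪ q₁ ∪ q₂)) + 1
        ∎)
      where
      open ≤-Reasoning
      rest = 𝓟 ─ (q₀ ∪ q₁ ∪ q₂)
    [𝓡∪q₁∪q₂]≥2 : 2 ≤ ⊓ᶠ 𝓛 (𝓡 ∪ q₁ ∪ q₂)
    [𝓡∪q₁∪q₂]≥2 = ≤-trans (≤-trans ∁[𝓛∪q₁∪q₂]≥2 (⊓ᶠ-𝓛∁[𝓛∪q∪q] (# 1) (# 2) (λ ()) refl λᶠ-𝓛∪q₁∪q₂))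
                          (⊓ᶠ-𝓛-mono (q₁ ∪ q₂) (𝓡 ∪ q₁ ∪ q₂))
    [𝓡∪q₁]≥2 : 2 ≤ ⊓ᶠ 𝓛 (𝓡 ∪ q₁)
    [𝓡∪q₁]≥2 = balance-≥ [𝓡∪q₀∪q₁]≥2 [𝓡∪q₁∪q₂]≥2
      (⊓ᶠ-supermodular 𝓛 (𝓡 ∪ q₀ ∪ q₁) (𝓡 ∪ q₁ ∪ q₂)
        (modular-∁ (uncross₃ (∁ (𝓡 ∪ q₀ ∪ q₁)) (∁ (𝓡 ∪ q₁ ∪ q₂)) λᶠ-∁[𝓡∪q₀∪q₁] λᶠ-∁[𝓡∪q₁∪q₂])))
      [𝓡∪q₀∪q₁∪q₂]≤2

lemma5p13 : ∀ {m n} (M : Matroid m) (L R : Subset m) (Q : Fin n → Subset m)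
    → Is42Flexipath M L Q R
    → ⊓ M L R ≡ 1
    → ⊓* M L R ≡ 1
    → (∀ i → ⊓ M L (Q i) ≡ 1)
    → n ≤ 3
lemma5p13 {n = 0} _ _ _ _ _ _ _ _ = z≤n
lemma5p13 {n = 1} _ _ _ _ _ _ _ _ = s≤s z≤n
lemma5p13 {n = 2} _ _ _ _ _ _ _ _ = s≤s (s≤s z≤n)
lemma5p13 {n = 3} _ _ _ _ _ _ _ _ = s≤s (s≤s (s≤s z≤n))
lemma5p13 {n = suc (suc (suc (suc n′)))} M L R Q flexi ⊓LR≡1 ⊓*LR≡1 ⊓LQ≡1 = ⊥-elim pigeonhole
  where
  module Relabelled (π : Permutation′ (4 + n′)) =
    FourParts M L R (λ t → Q (π ⟨$⟩ʳ t)) (relabel {M = M} π flexi) ⊓LR≡1 ⊓*LR≡1 (⊓LQ≡1 ∘ (π ⟨$⟩ʳ_))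
  open Relabelled using (no-two-low-pairs; no-two-high-pairs)

  pigeonhole : Empty.⊥
  pigeonhole
    with ⊓ M L (Q (# 0) ∪ Q (# 1)) ≤? 1 | ⊓ M L (Q (# 0) ∪ Q (# 2)) ≤? 1 | ⊓ M L (Q (# 0) ∪ Q (# 3)) ≤? 1
  ... | yes l₁ | yes l₂ | _      = no-two-low-pairs Perm.id (l₁ , l₂)
  ... | yes l₁ | no  _  | yes l₃ = no-two-low-pairs (transpose (# 2) (# 3)) (l₁ , l₃)
  ... | no  _  | yes l₂ | yes l₃ = no-two-low-pairs (transpose (# 1) (# 3)) (l₃ , l₂)
  ... | no  h₁ | no  h₂ | _      = no-two-high-pairs Perm.id (≰⇒> h₁ , ≰⇒> h₂)
  ... | no  h₁ | yes _  | no  h₃ = no-two-high-pairs (transpose (# 2) (# 3)) (≰⇒> h₁ , ≰⇒> h₃)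
  ... | yes _  | no  h₂ | no  h₃ = no-two-high-pairs (transpose (# 1) (# 3)) (≰⇒> h₃ , ≰⇒> h₂)
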